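{- Let $n\ge3$ and let $w$ be a tight Andr\'e I permutation in $\mathrm{And}_n^{I}$. Then $f(w)$ is not an Andr\'e I permutation.
   Context: Andr\'e I permutations: words are permutations of finite sets $Y$ of positive integers; the empty word $e$ and one-letter words are Andr\'e I; for $|Y|\ge2$ write $w=v\,\min(w)\,v'$; $w$ is Andr\'e I if $v,v'$ are Andr\'e I and $\max(vv')$ is a letter of $v'$. $\mathrm{And}_n^{I}$: Andr\'e I permutations of $\{1,\dots,n\}$ (each ends with $n$, so its first letter $m$ satisfies $m\le n-1$). The map $f$: for a permutation $w$ of $\{1,\dots,n\}$ with first letter $m\le n-1$, written $w=m\,v\,(m+1)\,v'$, $f(w)=(m+1)\,v\,m\,v'$ (transposition of the letters $m$ and $m+1$). Tight: $w=m\,v\,(m+1)\,v'\in\mathrm{And}_n^I$ (first letter $m$) is tight if (i) either $v=e$ or all letters of $v$ are less than $m$, and (ii) either $v'\ne e$ and the first letter of $v'$ is less than all letters of $w$ to its left, or $v'=e$ (and then $m=n-1$). -}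

module Defs where

open import Data.Nat using (ℕ; zero; suc; _<_; _≤_; _≡ᵇ_)
open import Data.Bool using (if_then_else_)
open import Data.List using (List; []; _∷_; [_]; _++_; map; upTo)
open import Data.List.Relation.Unary.All using (All)
open import Data.List.Membership.Propositional using (_∈_)
open import Data.List.Relation.Binary.Permutation.Propositional using (_↭_)
open import Data.Product using (Σ; _×_; ∃)
open import Data.Sum using (_⊎_)
open import Data.Empty using (⊥)
open import Relation.Binary.PropositionalEquality using (_≡_)

IsMaxIn : ℕ → List ℕ → Set
IsMaxIn x u = All (_≤ x) u

-- André I words (recursive definition of the paper):
--  * e and one-letter words are André I;
--  * for |w| ≥ 2, write w = v min(w) v'; w is André I iff v, v' are André I
--    and max(v v') is a letter of v'.
-- min(w) = m is encoded by: every other letter is strictly larger than m.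
data AndreI : List ℕ → Set where
  andre-empty  : AndreI []
  andre-single : (a : ℕ) → AndreI [ a ]
  andre-split  : (v : List ℕ) (m : ℕ) (v' : List ℕ) →
                 All (m <_) (v ++ v') →
                 AndreI v → AndreI v' →
                 (Σ ℕ λ x → x ∈ v' × IsMaxIn x (v ++ v')) →
                 AndreI (v ++ m ∷ v')

IsPermOf : ℕ → List ℕ → Set
IsPermOf n w = w ↭ map suc (upTo n)

AndI : ℕ → List ℕ → Set
AndI n w = IsPermOf n w × AndreI w

swapLetters : ℕ → List ℕ → List ℕ
swapLetters m = map (λ x → if x ≡ᵇ m then suc m else (if x ≡ᵇ suc m then m else x))

-- the map f: w = m v (m+1) v'  ↦  (m+1) v m v'  (m = first letter of w)
f : List ℕ → List ℕ
f []          = []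
f (m ∷ rest)  = swapLetters m (m ∷ rest)

Tight : List ℕ → Set
Tight []         = ⊥
Tight (m ∷ rest) =
  Σ (List ℕ) λ v → Σ (List ℕ) λ v' →
    (rest ≡ v ++ suc m ∷ v') ×
    All (_< m) v ×
    ((v' ≡ []) ⊎
     (Σ ℕ λ x → Σ (List ℕ) λ xs → (v' ≡ x ∷ xs) × All (x <_) (m ∷ v ++ [ suc m ])))

-- Write w = m v (m+1) v'. Since the letters of v lie below m, f(w) = (m+1) v m v'', where v'' is
-- v' with m and m+1 exchanged. An André I word of length at least 2 never starts with its
-- maximum, so (m+1) v m is not André I. If v' = e this is f(w) itself. Otherwise the first
-- letter x of v' is below every letter of (m+1) v m, and a prefix of an André I word whose
-- letters all exceed the following letter is again André I; so again f(w) is not André I.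
module Submission where

open import Defs
open import Data.Nat using (ℕ; zero; suc; _≤_; _<_; _≡ᵇ_)
open import Data.Nat.Properties using (<-irrefl; <-asym; <-≤-trans; m<n⇒m<1+n; n<1+n)
open import Data.Bool using (true; false; if_then_else_)
open import Data.List using (List; []; _∷_; [_]; _++_; map)
open import Data.List.Properties using (∷-injective; ++-assoc; ++-identityʳ; ++-conicalʳ; map-++; map-id-local)
open import Data.List.Relation.Unary.All using (All; []; _∷_; lookup)
import Data.List.Relation.Unary.All as All
open import Data.List.Relation.Unary.All.Properties using (++⁺; ++⁻ˡ)
open import Data.List.Relation.Unary.Any using (here; there)
open import Data.List.Membership.Propositional using (_∈_)
open import Data.List.Membership.Propositional.Properties using (∈-++⁺ʳ)
open import Data.Product using (Σ; _×_; _,_)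
open import Data.Sum using (_⊎_; inj₁; inj₂)
open import Data.Empty using (⊥-elim)
open import Relation.Binary.PropositionalEquality using (_≡_; _≢_; refl; sym; trans; cong; subst; module ≡-Reasoning)
open import Relation.Nullary using (¬_)

≡ᵇ-refl : ∀ m → (m ≡ᵇ m) ≡ true
≡ᵇ-refl zero    = refl
≡ᵇ-refl (suc m) = ≡ᵇ-refl m

≢⇒≡ᵇ-false : ∀ m n → m ≢ n → (m ≡ᵇ n) ≡ false
≢⇒≡ᵇ-false zero    zero    m≢n = ⊥-elim (m≢n refl)
≢⇒≡ᵇ-false zero    (suc n) _   = refl
≢⇒≡ᵇ-false (suc m) zero    _   = refl
≢⇒≡ᵇ-false (suc m) (suc n) m≢n = ≢⇒≡ᵇ-false m n (λ m≡n → m≢n (cong suc m≡n))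

-- swapLetters m is definitionally map (transpose m).
transpose : ℕ → ℕ → ℕ
transpose m x = if x ≡ᵇ m then suc m else (if x ≡ᵇ suc m then m else x)

transpose-left : ∀ m → transpose m m ≡ suc m
transpose-left m rewrite ≡ᵇ-refl m = refl

transpose-right : ∀ m → transpose m (suc m) ≡ m
transpose-right m
  rewrite ≢⇒≡ᵇ-false (suc m) m (λ eq → <-irrefl (sym eq) (n<1+n m)) | ≡ᵇ-refl m = refl

transpose-< : ∀ {m x} → x < m → transpose m x ≡ x
transpose-< {m} {x} x<m
  rewrite ≢⇒≡ᵇ-false x m (λ { refl → <-irrefl refl x<m })
        | ≢⇒≡ᵇ-false x (suc m) (λ { refl → <-irrefl refl (m<n⇒m<1+n x<m) }) = refl

f-∷-++-∷ : ∀ {m v} v' → All (_< m) v →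
           f (m ∷ v ++ suc m ∷ v') ≡ (suc m ∷ v ++ [ m ]) ++ swapLetters m v'
f-∷-++-∷ {m} {v} v' v<m = begin
  transpose m m ∷ map (transpose m) (v ++ suc m ∷ v')
    ≡⟨ cong (transpose m m ∷_) (map-++ (transpose m) v (suc m ∷ v')) ⟩
  transpose m m ∷ map (transpose m) v ++ transpose m (suc m) ∷ swapLetters m v'
    ≡⟨ cong (_∷ map (transpose m) v ++ transpose m (suc m) ∷ swapLetters m v') (transpose-left m) ⟩
  suc m ∷ map (transpose m) v ++ transpose m (suc m) ∷ swapLetters m v'
    ≡⟨ cong (λ u → suc m ∷ u ++ transpose m (suc m) ∷ swapLetters m v') (map-id-local (All.map transpose-< v<m)) ⟩
  suc m ∷ v ++ transpose m (suc m) ∷ swapLetters m v'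
    ≡⟨ cong (λ y → suc m ∷ v ++ y ∷ swapLetters m v') (transpose-right m) ⟩
  suc m ∷ v ++ m ∷ swapLetters m v'
    ≡⟨ cong (suc m ∷_) (sym (++-assoc v [ m ] (swapLetters m v'))) ⟩
  (suc m ∷ v ++ [ m ]) ++ swapLetters m v' ∎
  where open ≡-Reasoning

++-∷-≡-++-∷ : ∀ {A : Set} (a p : List A) μ b x xs → a ++ μ ∷ b ≡ p ++ x ∷ xs →
              (Σ (List A) λ c → a ≡ p ++ c × c ++ μ ∷ b ≡ x ∷ xs) ⊎
              (Σ (List A) λ d → p ≡ a ++ μ ∷ d × b ≡ d ++ x ∷ xs)
++-∷-≡-++-∷ []      []      μ b x xs eq = inj₁ ([] , refl , eq)
++-∷-≡-++-∷ []      (q ∷ p) μ b x xs eq with ∷-injective eq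
... | refl , b≡ = inj₂ (p , refl , b≡)
++-∷-≡-++-∷ (y ∷ a) []      μ b x xs eq = inj₁ (y ∷ a , refl , eq)
++-∷-≡-++-∷ (y ∷ a) (q ∷ p) μ b x xs eq with ∷-injective eq
... | refl , eq′ with ++-∷-≡-++-∷ a p μ b x xs eq′
...   | inj₁ (c , a≡ , c≡) = inj₁ (c , cong (y ∷_) a≡ , c≡)
...   | inj₂ (d , p≡ , b≡) = inj₂ (d , cong (y ∷_) p≡ , b≡)

AndreI-head-max⇒singleton : ∀ {x r} → AndreI (x ∷ r) → All (_< x) r → r ≡ []
AndreI-head-max⇒singleton w r<x = go w refl r<x
  where
  go : ∀ {u x r} → AndreI u → u ≡ x ∷ r → All (_< x) r → r ≡ []
  go (andre-single _) refl _ = refl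
  go (andre-split [] μ [] _ _ _ _) refl _ = refl
  go (andre-split [] μ (y ∷ b) μ< _ _ _) refl (y<μ ∷ _) = ⊥-elim (<-asym (lookup μ< (here refl)) y<μ)
  go (andre-split (y ∷ a) μ b _ _ _ (X , X∈b , ≤X)) refl r<x =
    ⊥-elim (<-irrefl refl (<-≤-trans (lookup r<x (∈-++⁺ʳ a (there X∈b))) (lookup ≤X (here refl))))

AndreI-prefix : ∀ {p x xs} → AndreI (p ++ x ∷ xs) → All (x <_) p → AndreI p
AndreI-prefix w x<p = go w refl x<p
  where
  -- The minimum of the word cannot occur in p, as x is smaller; so p is a prefix of the left factor.
  go : ∀ {u p x xs} → AndreI u → u ≡ p ++ x ∷ xs → All (x <_) p → AndreI p
  go {p = []}         andre-empty ()   _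
  go {p = _ ∷ _}      andre-empty ()   _
  go {p = []}         (andre-single _) refl _ = andre-empty
  go {p = _ ∷ []}     (andre-single _) ()   _
  go {p = _ ∷ _ ∷ _}  (andre-single _) ()   _
  go {p = p} {x} {xs} (andre-split a μ b μ< wa _ _) eq x<p with ++-∷-≡-++-∷ a p μ b x xs eq
  ... | inj₁ ([] , a≡ , c≡) with ∷-injective c≡
  ...   | refl , _ = subst AndreI (trans a≡ (++-identityʳ p)) wa
  go (andre-split a μ b μ< wa _ _) eq x<p | inj₁ (_ ∷ c , a≡ , c≡) with ∷-injective c≡
  ...   | refl , _ = go wa a≡ x<p
  go (andre-split a μ b μ< wa _ _) eq x<p | inj₂ (d , refl , refl) =
    ⊥-elim (<-asym (lookup μ< (∈-++⁺ʳ a (∈-++⁺ʳ d (here refl))))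
                   (lookup x<p (∈-++⁺ʳ a (here refl))))

suc-∷-++-not-AndreI : ∀ {m} v → All (_< m) v → ¬ AndreI (suc m ∷ v ++ [ m ])
suc-∷-++-not-AndreI {m} v v<m w
  with () ← ++-conicalʳ v [ m ] (AndreI-head-max⇒singleton w (++⁺ (All.map m<n⇒m<1+n v<m) (n<1+n m ∷ [])))

proposition6p1 : (n : ℕ) → 3 ≤ n → (w : List ℕ) → AndI n w → Tight w → ¬ AndreI (f w)
proposition6p1 _ _ [] _ ()
proposition6p1 _ _ (m ∷ _) _ (v , v' , refl , v<m , v'-shape) fw
  with fw′ ← subst AndreI (f-∷-++-∷ v' v<m) fw | v'-shape
... | inj₁ refl = suc-∷-++-not-AndreI v v<m (subst AndreI (++-identityʳ _) fw′)
... | inj₂ (x , xs , refl , x<m ∷ x<v++) =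
  suc-∷-++-not-AndreI v v<m
    (AndreI-prefix (subst (λ y → AndreI ((suc m ∷ v ++ [ m ]) ++ y ∷ swapLetters m xs)) (transpose-< x<m) fw′)
                   (m<n⇒m<1+n x<m ∷ ++⁺ (++⁻ˡ v x<v++) (x<m ∷ [])))
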